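{- Let $f,h$ be partial multi-valued functions on Baire space with $f\not\le_{\mathrm{W}} h$. Then there are at most countably many sets $D\subseteq\mathbb{N}$ such that $f\sqcap\chi_D\le_{\mathrm{W}} h$.
   Context: A partial multi-valued function $f$ on Baire space assigns to each $x\in\operatorname{dom}(f)\subseteq\mathbb{N}^\mathbb{N}$ a nonempty set $f(x)\subseteq\mathbb{N}^\mathbb{N}$. $f\le_{\mathrm{W}} g$ (Weihrauch reducibility) means there are partial computable functionals $\Phi,\Psi$ such that for every $p\in\operatorname{dom}(f)$, $\Phi(p)\in\operatorname{dom}(g)$ and for every $q\in g(\Phi(p))$, $\Psi(p,q)\in f(p)$. A natural number $n$ is identified with the constant sequence $n^\mathbb{N}\in\mathbb{N}^\mathbb{N}$; thus $\chi_D$, the characteristic function of $D\subseteq\mathbb{N}$, is viewed as a problem on Baire space with domain $\mathbb{N}$. $f\sqcap g$ is the problem with domain $\operatorname{dom}(f)\times\operatorname{dom}(g)$ (pairs coded in Baire space) with $(f\sqcap g)(x,z)=\{0\}\times f(x)\cup\{1\}\times g(z)$. -}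

module Defs where

open import Data.Nat using (ℕ; zero; suc; _*_; _<_)
open import Data.Fin using (Fin)
open import Data.Vec using (Vec; []; _∷_; lookup)
open import Data.Bool using (Bool; true; false)
open import Data.Product using (Σ; _×_; _,_)
open import Data.Sum using (_⊎_)
open import Relation.Binary.PropositionalEquality using (_≡_)

Baire : Set
Baire = ℕ → ℕ

_≈B_ : Baire → Baire → Set
p ≈B q = ∀ n → p n ≡ q n

const : ℕ → Baire
const n _ = n

-- pairing by interleaving: ⟨p,q⟩(2k) = p k, ⟨p,q⟩(2k+1) = q k
pair : Baire → Baire → Baire
pair p q zero    = p zero
pair p q (suc n) = pair q (λ k → p (suc k)) n

π₁ : Baire → Baire
π₁ w k = w (2 * k)

π₂ : Baire → Baire
π₂ w k = w (suc (2 * k))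

_∷B_ : ℕ → Baire → Baire
(a ∷B p) zero    = a
(a ∷B p) (suc n) = p n

tailB : Baire → Baire
tailB p n = p (suc n)

-- Partial computable functionals on Baire space:
-- partial recursive functions relative to an oracle α : ℕ → ℕ (Kleene).

data Code : ℕ → Set where
  zer  : ∀ {k} → Code k
  sucC : Code 1
  proj : ∀ {k} → Fin k → Code k
  orc  : Code 1
  comp : ∀ {k m} → Code m → Vec (Code k) m → Code k
  prec : ∀ {k} → Code k → Code (suc (suc k)) → Code (suc k)
  mu   : ∀ {k} → Code (suc k) → Code k

mutual
  data Eval (α : Baire) : ∀ {k} → Code k → Vec ℕ k → ℕ → Set where
    e-zer  : ∀ {k} {xs : Vec ℕ k} → Eval α zer xs 0
    e-suc  : ∀ {x} → Eval α sucC (x ∷ []) (suc x)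
    e-proj : ∀ {k} {i : Fin k} {xs} → Eval α (proj i) xs (lookup xs i)
    e-orc  : ∀ {x} → Eval α orc (x ∷ []) (α x)
    e-comp : ∀ {k m} {g : Code m} {hs : Vec (Code k) m} {xs ys v} →
             EvalAll α hs xs ys → Eval α g ys v → Eval α (comp g hs) xs v
    e-prec0 : ∀ {k} {g : Code k} {h : Code (suc (suc k))} {xs v} →
              Eval α g xs v → Eval α (prec g h) (zero ∷ xs) v
    e-precS : ∀ {k} {g : Code k} {h : Code (suc (suc k))} {n xs r v} →
              Eval α (prec g h) (n ∷ xs) r → Eval α h (n ∷ r ∷ xs) v →
              Eval α (prec g h) (suc n ∷ xs) v
    e-mu   : ∀ {k} {f : Code (suc k)} {xs y} →
             Eval α f (y ∷ xs) 0 →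
             (∀ z → z < y → Σ ℕ λ v → Eval α f (z ∷ xs) (suc v)) →
             Eval α (mu f) xs y

  data EvalAll (α : Baire) : ∀ {k m} → Vec (Code k) m → Vec ℕ k → Vec ℕ m → Set where
    []  : ∀ {k} {xs : Vec ℕ k} → EvalAll α [] xs []
    _∷_ : ∀ {k m} {h : Code k} {hs : Vec (Code k) m} {xs y ys} →
          Eval α h xs y → EvalAll α hs xs ys → EvalAll α (h ∷ hs) xs (y ∷ ys)

-- the partial computable functional with code c maps p to r
-- (i.e. Φ_c(p) is defined and equals r): r(n) = φ_c^p(n) for all n
Computes : Code 1 → Baire → Baire → Set
Computes c p r = ∀ n → Eval p c (n ∷ []) (r n)

record Problem : Set₁ where
  field
    dom : Baire → Set
    val : Baire → Baire → Set
open Problem public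

-- genuine partial multi-valued function on Baire space: domain and values are
-- sets of sequences (closed under pointwise equality), values nonempty on dom
record IsProblem (f : Problem) : Set where
  field
    dom-ext   : ∀ {x x'} → x ≈B x' → dom f x → dom f x'
    val-ext   : ∀ {x x' y y'} → x ≈B x' → y ≈B y' → val f x y → val f x' y'
    nonempty  : ∀ x → dom f x → Σ Baire λ y → val f x y

_≤W_ : Problem → Problem → Set
f ≤W g = Σ (Code 1) λ Φ → Σ (Code 1) λ Ψ →
  ∀ p → dom f p →
    Σ Baire λ r → Computes Φ p r × dom g r ×
      (∀ q → val g r q →
         Σ Baire λ s → Computes Ψ (pair p q) s × val f p s)

-- χ_D on Baire space, with domain ℕ (as constant sequences)
bit : Bool → ℕ
bit true  = 1
bit false = 0

χ : (ℕ → Bool) → Problem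
dom (χ D) z   = Σ ℕ λ n → z ≈B const n
val (χ D) z y = Σ ℕ λ n → (z ≈B const n) × (y ≈B const (bit (D n)))

-- f ⊓ g : input ⟨x,z⟩, output in {0}×f(x) ∪ {1}×g(z)
-- (a tagged output is coded as the tag prepended to the sequence)
_⊓_ : Problem → Problem → Problem
dom (f ⊓ g) w   = dom f (π₁ w) × dom g (π₂ w)
val (f ⊓ g) w y = (y 0 ≡ 0 × val f (π₁ w) (tailB y))
                ⊎ (y 0 ≡ 1 × val g (π₂ w) (tailB y))

{-# OPTIONS --safe #-}
-- A Weihrauch reduction is given by a pair of codes, of which there are only countably
-- many, so it suffices to show that one pair (Φ, Ψ) cannot witness both f ⊓ χ D ≤W h and
-- f ⊓ χ D' ≤W h when D n ≠ D' n.  Run both on the input ⟨x, n⟩: since Φ and Ψ are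
-- deterministic, both runs produce the same h-instance and, for every h-solution q, the
-- same answer s.  A right-hand answer would equal both bit (D n) and bit (D' n), so s is a
-- left-hand answer, i.e. a solution of f at x; and ⟨x, n⟩ as well as ⟨⟨x, n⟩, q⟩ are
-- uniformly computable from x and ⟨x, q⟩.  Hence f ≤W h.
module Submission where

open import Defs
open import Data.Nat using (ℕ; zero; suc; _+_; _*_)
open import Data.Nat.Properties using (<-cmp; 0≢1+n; +-suc; +-identityʳ)
import Data.Nat.Binary as ℕᵇ
import Data.Nat.Binary.Properties as ℕᵇ
open import Data.Fin using (Fin; toℕ) renaming (zero to fzero; suc to fsuc)
open import Data.Fin.Properties using (toℕ-injective)
open import Data.Vec using (Vec; []; _∷_)
open import Data.List using (List; []; _∷_)
open import Data.List.Properties using (∷-injectiveʳ)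
open import Data.Bool using (Bool; true; false; _≟_)
open import Data.Product using (Σ; ∃; _×_; _,_; proj₁; proj₂)
open import Data.Sum using (_⊎_; inj₁; inj₂)
open import Data.Empty using (⊥-elim)
open import Function using (_∘_)
open import Relation.Nullary using (¬_)
open import Relation.Nullary.Decidable using (decidable-stable)
open import Relation.Binary using (tri<; tri≈; tri>)
open import Relation.Binary.PropositionalEquality
  using (_≡_; _≢_; refl; sym; trans; cong; subst; module ≡-Reasoning)

mutual
  Eval-deterministic : ∀ {α k} {c : Code k} {xs v v'} →
                       Eval α c xs v → Eval α c xs v' → v ≡ v'
  Eval-deterministic e-zer e-zer = refl
  Eval-deterministic e-suc e-suc = refl
  Eval-deterministic e-proj e-proj = refl
  Eval-deterministic e-orc e-orc = refl
  Eval-deterministic (e-comp hs g) (e-comp hs' g') with EvalAll-deterministic hs hs'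
  ... | refl = Eval-deterministic g g'
  Eval-deterministic (e-prec0 g) (e-prec0 g') = Eval-deterministic g g'
  Eval-deterministic (e-precS r h) (e-precS r' h') with Eval-deterministic r r'
  ... | refl = Eval-deterministic h h'
  Eval-deterministic (e-mu {y = y} f0 fs) (e-mu {y = y'} f0' fs') with <-cmp y y'
  ... | tri≈ _ y≡y' _ = y≡y'
  ... | tri< y<y' _ _ = ⊥-elim (0≢1+n (Eval-deterministic f0 (proj₂ (fs' y y<y'))))
  ... | tri> _ _ y'<y = ⊥-elim (0≢1+n (Eval-deterministic f0' (proj₂ (fs y' y'<y))))

  EvalAll-deterministic : ∀ {α k m} {hs : Vec (Code k) m} {xs ys ys'} →
                          EvalAll α hs xs ys → EvalAll α hs xs ys' → ys ≡ ys'
  EvalAll-deterministic [] [] = refl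
  EvalAll-deterministic (e ∷ es) (e' ∷ es')
    with Eval-deterministic e e' | EvalAll-deterministic es es'
  ... | refl | refl = refl

Computes-deterministic : ∀ {c p r r'} → Computes c p r → Computes c p r' → r ≈B r'
Computes-deterministic Φr Φr' n = Eval-deterministic (Φr n) (Φr' n)

Computes-resp-≈B : ∀ {c p r r'} → r ≈B r' → Computes c p r → Computes c p r'
Computes-resp-≈B r≈r' Φr n = subst (Eval _ _ _) (r≈r' n) (Φr n)

mutual
  _∘ᶜ_ : ∀ {k} → Code k → Code 1 → Code k
  zer       ∘ᶜ O = zer
  sucC      ∘ᶜ O = sucC
  proj i    ∘ᶜ O = proj i
  orc       ∘ᶜ O = O
  comp g hs ∘ᶜ O = comp (g ∘ᶜ O) (hs ∘ᶜ* O)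
  prec g h  ∘ᶜ O = prec (g ∘ᶜ O) (h ∘ᶜ O)
  mu f      ∘ᶜ O = mu (f ∘ᶜ O)

  _∘ᶜ*_ : ∀ {k m} → Vec (Code k) m → Code 1 → Vec (Code k) m
  []       ∘ᶜ* O = []
  (h ∷ hs) ∘ᶜ* O = h ∘ᶜ O ∷ hs ∘ᶜ* O

module _ {α β O} (Oβ : Computes O α β) where
  mutual
    Eval-∘ᶜ : ∀ {k} {c : Code k} {xs v} → Eval β c xs v → Eval α (c ∘ᶜ O) xs v
    Eval-∘ᶜ e-zer = e-zer
    Eval-∘ᶜ e-suc = e-suc
    Eval-∘ᶜ e-proj = e-proj
    Eval-∘ᶜ (e-orc {x}) = Oβ x
    Eval-∘ᶜ (e-comp hs g) = e-comp (EvalAll-∘ᶜ hs) (Eval-∘ᶜ g)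
    Eval-∘ᶜ (e-prec0 g) = e-prec0 (Eval-∘ᶜ g)
    Eval-∘ᶜ (e-precS r h) = e-precS (Eval-∘ᶜ r) (Eval-∘ᶜ h)
    Eval-∘ᶜ (e-mu f0 fs) = e-mu (Eval-∘ᶜ f0) (λ z z<y → proj₁ (fs z z<y) , Eval-∘ᶜ (proj₂ (fs z z<y)))

    EvalAll-∘ᶜ : ∀ {k m} {hs : Vec (Code k) m} {xs ys} →
                 EvalAll β hs xs ys → EvalAll α (hs ∘ᶜ* O) xs ys
    EvalAll-∘ᶜ [] = []
    EvalAll-∘ᶜ (e ∷ es) = Eval-∘ᶜ e ∷ EvalAll-∘ᶜ es

  Computes-∘ᶜ : ∀ {c r} → Computes c β r → Computes (c ∘ᶜ O) α r
  Computes-∘ᶜ Φr n = Eval-∘ᶜ (Φr n)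

notBit : ℕ → ℕ
notBit zero    = 1
notBit (suc _) = 0

parity : ℕ → ℕ
parity zero    = 0
parity (suc y) = notBit (parity y)

half : ℕ → ℕ
half zero    = 0
half (suc y) = parity y + half y

double : ℕ → ℕ
double zero    = 0
double (suc k) = suc (suc (double k))

ifZero : ℕ → ℕ → ℕ → ℕ
ifZero zero    a _ = a
ifZero (suc _) _ b = b

notBitᶜ : Code 1
notBitᶜ = prec (comp sucC (zer ∷ [])) zer

notBit-eval : ∀ {α} y → Eval α notBitᶜ (y ∷ []) (notBit y)
notBit-eval zero    = e-prec0 (e-comp (e-zer ∷ []) e-suc)
notBit-eval (suc y) = e-precS (notBit-eval y) e-zer

parityᶜ : Code 1
parityᶜ = prec zer (comp notBitᶜ (proj (fsuc fzero) ∷ []))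

parity-eval : ∀ {α} y → Eval α parityᶜ (y ∷ []) (parity y)
parity-eval zero    = e-prec0 e-zer
parity-eval (suc y) = e-precS (parity-eval y) (e-comp (e-proj ∷ []) (notBit-eval _))

+ᶜ : Code 2
+ᶜ = prec (proj fzero) (comp sucC (proj (fsuc fzero) ∷ []))

+-eval : ∀ {α} a b → Eval α +ᶜ (a ∷ b ∷ []) (a + b)
+-eval zero    b = e-prec0 e-proj
+-eval (suc a) b = e-precS (+-eval a b) (e-comp (e-proj ∷ []) e-suc)

halfᶜ : Code 1
halfᶜ = prec zer (comp +ᶜ (comp parityᶜ (proj fzero ∷ []) ∷ proj (fsuc fzero) ∷ []))

half-eval : ∀ {α} y → Eval α halfᶜ (y ∷ []) (half y)
half-eval zero    = e-prec0 e-zer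
half-eval (suc y) =
  e-precS (half-eval y) (e-comp (e-comp (e-proj ∷ []) (parity-eval y) ∷ e-proj ∷ []) (+-eval _ _))

doubleᶜ : Code 1
doubleᶜ = prec zer (comp sucC (comp sucC (proj (fsuc fzero) ∷ []) ∷ []))

double-eval : ∀ {α} y → Eval α doubleᶜ (y ∷ []) (double y)
double-eval zero    = e-prec0 e-zer
double-eval (suc y) = e-precS (double-eval y) (e-comp (e-comp (e-proj ∷ []) e-suc ∷ []) e-suc)

ifZeroᶜ : Code 3
ifZeroᶜ = prec (proj fzero) (proj (fsuc (fsuc (fsuc fzero))))

ifZero-eval : ∀ {α} b x y → Eval α ifZeroᶜ (b ∷ x ∷ y ∷ []) (ifZero b x y)
ifZero-eval zero    x y = e-prec0 e-proj
ifZero-eval (suc b) x y = e-precS (ifZero-eval b x y) e-proj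

parity-double : ∀ k → parity (double k) ≡ 0
parity-double zero = refl
parity-double (suc k) rewrite parity-double k = refl

half-double : ∀ k → half (double k) ≡ k
half-double zero = refl
half-double (suc k) rewrite parity-double k | half-double k = refl

double≡2* : ∀ k → double k ≡ 2 * k
double≡2* zero = refl
double≡2* (suc k) rewrite double≡2* k | +-identityʳ k | +-suc k k = refl

even-or-odd : ∀ y → ∃ (λ k → y ≡ double k) ⊎ ∃ (λ k → y ≡ suc (double k))
even-or-odd zero = inj₁ (0 , refl)
even-or-odd (suc y) with even-or-odd y
... | inj₁ (k , refl) = inj₂ (k , refl)
... | inj₂ (k , refl) = inj₁ (suc k , refl)

pair-double : ∀ p q k → pair p q (double k) ≡ p k
pair-double p q zero    = refl
pair-double p q (suc k) = pair-double (tailB p) (tailB q) k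

pair-suc-double : ∀ p q k → pair p q (suc (double k)) ≡ q k
pair-suc-double p q zero    = refl
pair-suc-double p q (suc k) = pair-suc-double (tailB p) (tailB q) k

pair-by-parity : ∀ p q y → ifZero (parity y) (p (half y)) (q (half y)) ≡ pair p q y
pair-by-parity p q y with even-or-odd y
... | inj₁ (k , refl) rewrite parity-double k | half-double k = sym (pair-double p q k)
... | inj₂ (k , refl) rewrite parity-double k | half-double k = sym (pair-suc-double p q k)

pair-cong : ∀ {p p' q q'} → p ≈B p' → q ≈B q' → pair p q ≈B pair p' q'
pair-cong p≈p' q≈q' zero    = p≈p' 0
pair-cong p≈p' q≈q' (suc n) = pair-cong q≈q' (p≈p' ∘ suc) n

π₁-pair : ∀ p q → π₁ (pair p q) ≈B p
π₁-pair p q k rewrite sym (double≡2* k) = pair-double p q k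

π₂-pair : ∀ p q → π₂ (pair p q) ≈B q
π₂-pair p q k rewrite sym (double≡2* k) = pair-suc-double p q k

constᶜ : ℕ → Code 1
constᶜ zero    = zer
constᶜ (suc n) = comp sucC (constᶜ n ∷ [])

Computes-const : ∀ {α} n → Computes (constᶜ n) α (const n)
Computes-const zero    _ = e-zer
Computes-const (suc n) k = e-comp (Computes-const n k ∷ []) e-suc

Computes-id : ∀ {α} → Computes orc α α
Computes-id _ = e-orc

pairᶜ : Code 1 → Code 1 → Code 1
pairᶜ A B = comp ifZeroᶜ (parityᶜ ∷ comp A (halfᶜ ∷ []) ∷ comp B (halfᶜ ∷ []) ∷ [])

Computes-pair : ∀ {A B α a b} → Computes A α a → Computes B α b →
                Computes (pairᶜ A B) α (pair a b)
Computes-pair {a = a} {b} Aa Bb = Computes-resp-≈B (pair-by-parity a b) λ y →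
  e-comp (parity-eval y ∷ e-comp (half-eval y ∷ []) (Aa _) ∷ e-comp (half-eval y ∷ []) (Bb _) ∷ [])
         (ifZero-eval _ _ _)

π₁ᶜ : Code 1
π₁ᶜ = comp orc (doubleᶜ ∷ [])

Computes-π₁ : ∀ {α} → Computes π₁ᶜ α (π₁ α)
Computes-π₁ {α} = Computes-resp-≈B (cong α ∘ double≡2*) λ k → e-comp (double-eval k ∷ []) e-orc

π₂ᶜ : Code 1
π₂ᶜ = comp orc (comp sucC (doubleᶜ ∷ []) ∷ [])

Computes-π₂ : ∀ {α} → Computes π₂ᶜ α (π₂ α)
Computes-π₂ {α} = Computes-resp-≈B (cong (α ∘ suc) ∘ double≡2*) λ k →
  e-comp (e-comp (double-eval k ∷ []) e-suc ∷ []) e-orc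

tailᶜ : Code 1 → Code 1
tailᶜ C = comp C (sucC ∷ [])

Computes-tail : ∀ {C α s} → Computes C α s → Computes (tailᶜ C) α (tailB s)
Computes-tail Cs n = e-comp (e-suc ∷ []) (Cs (suc n))

Computes-rearrange : ∀ n x q →
  Computes (pairᶜ (pairᶜ π₁ᶜ (constᶜ n)) π₂ᶜ) (pair x q) (pair (pair x (const n)) q)
Computes-rearrange n x q =
  Computes-resp-≈B (pair-cong (pair-cong (π₁-pair x q) (λ _ → refl)) (π₂-pair x q))
    (Computes-pair (Computes-pair Computes-π₁ (Computes-const n)) Computes-π₂)

bit-injective : ∀ a b → bit a ≡ bit b → a ≡ b
bit-injective true  true  _ = refl
bit-injective false false _ = refl

WitnessedBy : Problem → Problem → Code 1 → Code 1 → Set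
WitnessedBy f g Φ Ψ = ∀ p → dom f p →
  Σ Baire λ r → Computes Φ p r × dom g r ×
    (∀ q → val g r q → Σ Baire λ s → Computes Ψ (pair p q) s × val f p s)

left-solution-of-disagreement : ∀ {f D D' w s s'} → D (π₂ w 0) ≢ D' (π₂ w 0) → s ≈B s' →
  val (f ⊓ χ D) w s → val (f ⊓ χ D') w s' → val f (π₁ w) (tailB s)
left-solution-of-disagreement _ _ (inj₁ (_ , fs)) _ = fs
left-solution-of-disagreement _ s≈s' (inj₂ (s₀≡1 , _)) (inj₁ (s'₀≡0 , _)) =
  ⊥-elim (0≢1+n (trans (sym s'₀≡0) (trans (sym (s≈s' 0)) s₀≡1)))
left-solution-of-disagreement {D = D} {D'} {w} Dn≢D'n s≈s'
  (inj₂ (_ , m , w≈m , s≈Dm)) (inj₂ (_ , m' , w≈m' , s'≈D'm')) = ⊥-elim (Dn≢D'n (begin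
    D (π₂ w 0)  ≡⟨ cong D (w≈m 0) ⟩
    D m         ≡⟨ bit-injective _ _ (trans (sym (s≈Dm 0)) (trans (s≈s' 1) (s'≈D'm' 0))) ⟩
    D' m'       ≡⟨ cong D' (sym (w≈m' 0)) ⟩
    D' (π₂ w 0) ∎))
  where open ≡-Reasoning

module _ {f h : Problem} (f-problem : IsProblem f) (h-problem : IsProblem h)
         {D D' : ℕ → Bool} {Φ Ψ : Code 1} {n : ℕ} (Dn≢D'n : D n ≢ D' n)
         (red : WitnessedBy (f ⊓ χ D) h Φ Ψ) (red' : WitnessedBy (f ⊓ χ D') h Φ Ψ) where
  open IsProblem

  dom-paired : ∀ E {x} → dom f x → dom (f ⊓ χ E) (pair x (const n))
  dom-paired _ {x} fx = dom-ext f-problem (sym ∘ π₁-pair x (const n)) fx , n , π₂-pair x (const n)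

  Φ₀ Ψ₀ : Code 1
  Φ₀ = Φ ∘ᶜ pairᶜ orc (constᶜ n)
  Ψ₀ = tailᶜ (Ψ ∘ᶜ pairᶜ (pairᶜ π₁ᶜ (constᶜ n)) π₂ᶜ)

  Φ₀Ψ₀-witness : WitnessedBy f h Φ₀ Ψ₀
  Φ₀Ψ₀-witness x fx with red _ (dom-paired D fx) | red' _ (dom-paired D' fx)
  ... | r , Φr , hr , back | r' , Φr' , _ , back' =
    r , Computes-∘ᶜ (Computes-pair Computes-id (Computes-const n)) Φr , hr , back₀
    where
    back₀ : ∀ q → val h r q → Σ Baire λ s → Computes Ψ₀ (pair x q) s × val f x s
    back₀ q hq with back q hq
                  | back' q (val-ext h-problem (Computes-deterministic Φr Φr') (λ _ → refl) hq)
    ... | s , Ψs , v | s' , Ψs' , v' =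
      tailB s ,
      Computes-tail (Computes-∘ᶜ (Computes-rearrange n x q) Ψs) ,
      val-ext f-problem (π₁-pair x (const n)) (λ _ → refl)
        (left-solution-of-disagreement {f = f} {w = pair x (const n)}
          Dn≢D'n (Computes-deterministic Ψs Ψs') v v')

  common-witness⇒≤W : f ≤W h
  common-witness⇒≤W = Φ₀ , Ψ₀ , Φ₀Ψ₀-witness

unary : ℕ → List Bool → List Bool
unary zero    bs = false ∷ bs
unary (suc n) bs = true ∷ unary n bs

unary-injective : ∀ m n {bs cs} → unary m bs ≡ unary n cs → m ≡ n × bs ≡ cs
unary-injective zero    zero    refl = refl , refl
unary-injective (suc m) (suc n) eq with unary-injective m n (∷-injectiveʳ eq)
... | refl , bs≡cs = refl , bs≡cs

tag : ∀ {k} → Code k → ℕ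
tag zer        = 0
tag sucC       = 1
tag (proj _)   = 2
tag orc        = 3
tag (comp _ _) = 4
tag (prec _ _) = 5
tag (mu _)     = 6

-- Indexing by the tag lets the coverage checker discard pairs of distinct constructors.
data HasTag : ∀ {k} → Code k → ℕ → Set where
  zer  : ∀ {k} → HasTag (zer {k}) 0
  sucC : HasTag sucC 1
  proj : ∀ {k} (i : Fin k) → HasTag (proj i) 2
  orc  : HasTag orc 3
  comp : ∀ {k m} (g : Code m) (hs : Vec (Code k) m) → HasTag (comp g hs) 4
  prec : ∀ {k} (g : Code k) (h : Code (suc (suc k))) → HasTag (prec g h) 5
  mu   : ∀ {k} (f : Code (suc k)) → HasTag (mu f) 6

hasTag : ∀ {k} (c : Code k) → HasTag c (tag c)
hasTag zer        = zer
hasTag sucC       = sucC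
hasTag (proj i)   = proj i
hasTag orc        = orc
hasTag (comp g hs) = comp g hs
hasTag (prec g h) = prec g h
hasTag (mu f)     = mu f

mutual
  encode : ∀ {k} → Code k → List Bool → List Bool
  encode c bs = unary (tag c) (encodeFields c bs)

  encodeFields : ∀ {k} → Code k → List Bool → List Bool
  encodeFields zer                 bs = bs
  encodeFields sucC                bs = bs
  encodeFields (proj i)            bs = unary (toℕ i) bs
  encodeFields orc                 bs = bs
  encodeFields (comp {m = m} g hs) bs = unary m (encode g (encodeAll hs bs))
  encodeFields (prec g h)          bs = encode g (encode h bs)
  encodeFields (mu f)              bs = encode f bs

  encodeAll : ∀ {k m} → Vec (Code k) m → List Bool → List Bool
  encodeAll []       bs = bs
  encodeAll (c ∷ cs) bs = encode c (encodeAll cs bs)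

mutual
  encode-injective : ∀ {k} (c c' : Code k) {bs cs} →
                     encode c bs ≡ encode c' cs → c ≡ c' × bs ≡ cs
  encode-injective c c' eq with unary-injective (tag c) (tag c') eq
  ... | tag≡ , fields≡ =
    encodeFields-injective (hasTag c) (subst (HasTag c') (sym tag≡) (hasTag c')) fields≡

  encodeFields-injective : ∀ {k t} {c c' : Code k} {bs cs} → HasTag c t → HasTag c' t →
                           encodeFields c bs ≡ encodeFields c' cs → c ≡ c' × bs ≡ cs
  encodeFields-injective zer  zer  refl = refl , refl
  encodeFields-injective sucC sucC refl = refl , refl
  encodeFields-injective orc  orc  refl = refl , refl
  encodeFields-injective (proj i) (proj j) eq with unary-injective (toℕ i) (toℕ j) eq
  ... | i≡j , bs≡cs rewrite toℕ-injective i≡j = refl , bs≡cs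
  encodeFields-injective (comp {m = m} g hs) (comp {m = m'} g' hs') eq
    with unary-injective m m' eq
  ... | refl , eq₁ with encode-injective g g' eq₁
  ... | refl , eq₂ with encodeAll-injective hs hs' eq₂
  ... | refl , bs≡cs = refl , bs≡cs
  encodeFields-injective (prec g h) (prec g' h') eq with encode-injective g g' eq
  ... | refl , eq₁ with encode-injective h h' eq₁
  ... | refl , bs≡cs = refl , bs≡cs
  encodeFields-injective (mu f) (mu f') eq with encode-injective f f' eq
  ... | refl , bs≡cs = refl , bs≡cs

  encodeAll-injective : ∀ {k m} (cs cs' : Vec (Code k) m) {bs bs'} →
                        encodeAll cs bs ≡ encodeAll cs' bs' → cs ≡ cs' × bs ≡ bs'
  encodeAll-injective []       []         eq = refl , eq
  encodeAll-injective (c ∷ cs) (c' ∷ cs') eq with encode-injective c c' eq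
  ... | refl , eq₁ with encodeAll-injective cs cs' eq₁
  ... | refl , bs≡bs' = refl , bs≡bs'

fromBits : List Bool → ℕᵇ.ℕᵇ
fromBits []          = ℕᵇ.zero
fromBits (true ∷ bs)  = ℕᵇ.2[1+ fromBits bs ]
fromBits (false ∷ bs) = ℕᵇ.1+[2 fromBits bs ]

fromBits-injective : ∀ bs cs → fromBits bs ≡ fromBits cs → bs ≡ cs
fromBits-injective []           []           _  = refl
fromBits-injective []           (true ∷ _)   ()
fromBits-injective []           (false ∷ _)  ()
fromBits-injective (true ∷ _)   []           ()
fromBits-injective (false ∷ _)  []           ()
fromBits-injective (true ∷ _)   (false ∷ _)  ()
fromBits-injective (false ∷ _)  (true ∷ _)   ()
fromBits-injective (true ∷ bs)  (true ∷ cs)  eq = cong (true ∷_) (fromBits-injective bs cs (ℕᵇ.2[1+_]-injective eq))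
fromBits-injective (false ∷ bs) (false ∷ cs) eq = cong (false ∷_) (fromBits-injective bs cs (ℕᵇ.1+[2_]-injective eq))

codePairIndex : Code 1 → Code 1 → ℕ
codePairIndex Φ Ψ = ℕᵇ.toℕ (fromBits (encode Φ (encode Ψ [])))

codePairIndex-injective : ∀ {Φ Ψ Φ' Ψ'} → codePairIndex Φ Ψ ≡ codePairIndex Φ' Ψ' → Φ ≡ Φ' × Ψ ≡ Ψ'
codePairIndex-injective {Φ} {Ψ} {Φ'} {Ψ'} eq
  with encode-injective Φ Φ' (fromBits-injective _ _ (ℕᵇ.toℕ-injective eq))
... | refl , eq₁ with encode-injective Ψ Ψ' eq₁
... | refl , _ = refl , refl

mainTheorem9 : (f h : Problem) → IsProblem f → IsProblem h → ¬ (f ≤W h) →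
    Σ ((D : ℕ → Bool) → (f ⊓ χ D) ≤W h → ℕ) λ c →
      ∀ D D' (p : (f ⊓ χ D) ≤W h) (p' : (f ⊓ χ D') ≤W h) →
        c D p ≡ c D' p' → ∀ n → D n ≡ D' n
mainTheorem9 f h f-problem h-problem f≰h = index , index-determines
  where
  index : (D : ℕ → Bool) → (f ⊓ χ D) ≤W h → ℕ
  index _ (Φ , Ψ , _) = codePairIndex Φ Ψ

  index-determines : ∀ D D' (p : (f ⊓ χ D) ≤W h) (p' : (f ⊓ χ D') ≤W h) →
                     index D p ≡ index D' p' → ∀ n → D n ≡ D' n
  index-determines D D' (Φ , Ψ , red) (Φ' , Ψ' , red') same n
    with codePairIndex-injective {Φ} {Ψ} {Φ'} {Ψ'} same
  ... | refl , refl = decidable-stable (D n ≟ D' n) λ Dn≢D'n →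
    f≰h (common-witness⇒≤W f-problem h-problem Dn≢D'n red red')
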